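{- Let $P$ be a Horn mca-program and let $t$ be a $P$-computation. Then the result $R_t$ of $t$ is a supported model of $P$.
   Context: Let $\mathit{At}$ be a set of propositional atoms. An mc-atom over $\mathit{At}$ is an expression $kX$, where $k$ is a non-negative integer and $X \subseteq \mathit{At}$ is finite with $k \leq |X|$; $\mathit{aset}(kX) = X$. An mc-literal is $A$ or $\mathbf{not}(A)$ for an mc-atom $A$. An mca-clause $r$ is an expression $H \leftarrow L_1, \ldots, L_m$ ($m \geq 0$), where $H$ is an mc-atom and the $L_i$ are mc-literals, with $\mathit{hd}(r) = H$, $\mathit{bd}(r) = \{L_1, \ldots, L_m\}$, and $\mathit{hset}(r) = \mathit{aset}(H)$. An mca-program is a set of mca-clauses. It is Horn if no clause body contains a literal of the form $\mathbf{not}(A)$. For a set $Q$ of clauses, $\mathit{hset}(Q) = \bigcup\{\mathit{hset}(r) : r \in Q\}$. Satisfaction, for $M \subseteq \mathit{At}$: - $M \models kX$ iff $|M \cap X| \geq k$. - $M \models \mathbf{not}(kX)$ iff $|M \cap X| < k$. - $M \models \mathit{bd}(r)$ iff $M$ satisfies all literals of $\mathit{bd}(r)$. Operators, supported models and computations: - $P(M) = \{r \in P : M \models \mathit{bd}(r)\}$. - $T^{\mathit{nd}}_P(M)$ is the set of all $M'$ with $M' \subseteq \mathit{hset}(P(M))$ and $M' \models \mathit{hd}(r)$ for all $r \in P(M)$. - $M$ is a supported model of $P$ if $M \in T^{\mathit{nd}}_P(M)$. - A $P$-computation is a sequence $(X_n)_{n \geq 0}$ with $X_0 = \emptyset$ and,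 for all $n$, $X_n \subseteq X_{n+1}$ and $X_{n+1} \in T^{\mathit{nd}}_P(X_n)$. - Its result is $R_t = \bigcup_n X_n$. -}

module Defs where

open import Data.Nat using (ℕ; zero; suc; _≤_)
open import Data.List using (List; length)
open import Data.List.Membership.Propositional using (_∈_)
open import Data.List.Relation.Unary.All using (All)
open import Data.List.Relation.Unary.Unique.Propositional using (Unique)
open import Data.Product using (Σ; ∃; _×_; _,_)
open import Relation.Nullary using (¬_)
open import Relation.Unary using (Pred; _⊆_)
open import Data.Empty using (⊥)
open import Data.Unit using (⊤)
open import Level using (0ℓ)
open import Relation.Binary.PropositionalEquality using (_≡_)

module _ (At : Set) where

  record FinSet : Set where
    constructor finset
    field
      elems  : List At
      unique : Unique elems

  open FinSet public

  record MCAtom : Set where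
    constructor mcatom
    field
      k     : ℕ
      X     : FinSet
      k≤∣X∣ : k ≤ length (elems X)

  open MCAtom public

  aset : MCAtom → FinSet
  aset = X

  data MCLiteral : Set where
    pos : MCAtom → MCLiteral
    neg : MCAtom → MCLiteral

  record Clause : Set where
    constructor _←_
    field
      hd : MCAtom
      bd : List MCLiteral

  open Clause public

  hset : Clause → FinSet
  hset r = aset (hd r)

  Program : Set₁
  Program = Pred Clause 0ℓ

  Interp : Set₁
  Interp = Pred At 0ℓ

  isPos : MCLiteral → Set
  isPos (pos _) = ⊤
  isPos (neg _) = ⊥

  Horn : Program → Set
  Horn P = ∀ r → P r → All isPos (bd r)

  -- |M ∩ X| ≥ k : there are k distinct atoms lying in both X and M
  AtLeast : ℕ → FinSet → Interp → Set
  AtLeast k S M = Σ (List At) λ ys →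
    Unique ys × length ys ≡ k × All (λ a → a ∈ elems S × M a) ys

  _⊨A_ : Interp → MCAtom → Set
  M ⊨A A = AtLeast (k A) (X A) M

  _⊨L_ : Interp → MCLiteral → Set
  M ⊨L pos A = M ⊨A A
  M ⊨L neg A = ¬ (M ⊨A A)

  _⊨B_ : Interp → List MCLiteral → Set
  M ⊨B B = All (M ⊨L_) B

  InTnd : Program → Interp → Interp → Set
  InTnd P M M' =
    (∀ a → M' a → ∃ λ r → P r × M ⊨B bd r × a ∈ elems (hset r))
    × (∀ r → P r → M ⊨B bd r → M' ⊨A hd r)

  SupportedModel : Program → Interp → Set
  SupportedModel P M = InTnd P M M

  record Computation (P : Program) : Set₁ where
    field
      Xs     : ℕ → Interp
      start  : ∀ a → ¬ Xs zero a
      mono   : ∀ n → Xs n ⊆ Xs (suc n)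
      step   : ∀ n → InTnd P (Xs n) (Xs (suc n))

  open Computation public

  result : {P : Program} → Computation P → Interp
  result t a = ∃ λ n → Xs t n a

{-# OPTIONS --safe #-}
-- Horn bodies are monotone, so a body satisfied by a stage X_n is satisfied by R_t;
-- conversely a body satisfied by R_t is witnessed by finitely many atoms, which all
-- lie in a single stage X_N of the increasing chain. Hence an atom entering at X_{n+1}
-- is supported by a clause whose body R_t satisfies, and a clause whose body R_t
-- satisfies already fires at X_N, putting its head into X_{N+1} ⊆ R_t.
module Submission where

open import Defs
open import Data.Nat using (ℕ; zero; suc; _≤_; _≤′_; ≤′-refl; ≤′-step; _⊔_)
open import Data.Nat.Properties using (≤⇒≤′; m≤m⊔n; m≤n⊔m)
open import Data.List using (List; _∷_)
open import Data.List.Membership.Propositional using (_∈_)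
open import Data.List.Relation.Unary.All as All using (All; []; _∷_)
open import Data.Product using (∃; _×_; _,_; proj₁; proj₂)
open import Data.Empty using (⊥-elim)
open import Level using (0ℓ)
open import Relation.Unary using (Pred; _⊆_; ⋃)

module Chain {A : Set} (Xs : ℕ → Pred A 0ℓ) (mono : ∀ n → Xs n ⊆ Xs (suc n)) where

  chain-mono : ∀ {m n} → m ≤ n → Xs m ⊆ Xs n
  chain-mono m≤n = go (≤⇒≤′ m≤n)
    where
    go : ∀ {m n} → m ≤′ n → Xs m ⊆ Xs n
    go ≤′-refl         x = x
    go (≤′-step m≤′n) x = mono _ (go m≤′n x)

  All-⋃-stage : ∀ {ys : List A} → All (⋃ ℕ Xs) ys → ∃ λ N → All (Xs N) ys
  All-⋃-stage []              = 0 , []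
  All-⋃-stage ((m , y) ∷ ys) with All-⋃-stage ys
  ... | n , ys′ = m ⊔ n , chain-mono (m≤m⊔n m n) y ∷ All.map (chain-mono (m≤n⊔m m n)) ys′

module _ {At : Set} where

  ⊨A-mono : ∀ A {M M′ : Interp At} → M ⊆ M′ → _⊨A_ At M A → _⊨A_ At M′ A
  ⊨A-mono _ M⊆M′ (ys , unique , len , inS∩M) =
    ys , unique , len , All.map (λ (y∈S , y∈M) → y∈S , M⊆M′ y∈M) inS∩M

  ⊨B-mono : ∀ {B} {M M′ : Interp At} → All (isPos At) B → M ⊆ M′ → _⊨B_ At M B → _⊨B_ At M′ B
  ⊨B-mono []                   M⊆M′ []        = []
  ⊨B-mono {pos A ∷ B} (_ ∷ pB) M⊆M′ (sA ∷ sB) = ⊨A-mono A M⊆M′ sA ∷ ⊨B-mono pB M⊆M′ sB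

  module _ (Xs : ℕ → Interp At) (mono : ∀ n → Xs n ⊆ Xs (suc n)) where
    open Chain Xs mono

    ⊨A-⋃-stage : ∀ A → _⊨A_ At (⋃ ℕ Xs) A → ∃ λ N → _⊨A_ At (Xs N) A
    ⊨A-⋃-stage _ (ys , unique , len , inS∩⋃) with All.unzip inS∩⋃
    ... | inS , in⋃ with All-⋃-stage in⋃
    ...   | N , inXₙ = N , ys , unique , len , All.zip (inS , inXₙ)

    ⊨B-⋃-stage : ∀ {B} → All (isPos At) B → _⊨B_ At (⋃ ℕ Xs) B → ∃ λ N → _⊨B_ At (Xs N) B
    ⊨B-⋃-stage []                   []        = 0 , []
    ⊨B-⋃-stage {pos A ∷ B} (_ ∷ pB) (sA ∷ sB) with ⊨A-⋃-stage A sA | ⊨B-⋃-stage pB sB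
    ... | m , sA′ | n , sB′ =
      m ⊔ n , ⊨A-mono A (chain-mono (m≤m⊔n m n)) sA′ ∷ ⊨B-mono pB (chain-mono (m≤n⊔m m n)) sB′

proposition5 : (At : Set) (P : Program At) → Horn At P →
    (t : Computation At P) → SupportedModel At P (result At t)
proposition5 At P horn t = supported , closed
  where
  supported : ∀ a → result At t a →
              ∃ λ r → P r × _⊨B_ At (result At t) (bd r) × a ∈ elems (hset At r)
  supported a (zero  , a∈X₀)   = ⊥-elim (start t a a∈X₀)
  supported a (suc n , a∈Xₙ₊₁) with proj₁ (step t n) a a∈Xₙ₊₁
  ... | r , r∈P , Xₙ⊨bd , a∈hset = r , r∈P , ⊨B-mono (horn r r∈P) (n ,_) Xₙ⊨bd , a∈hset

  closed : ∀ r → P r → _⊨B_ At (result At t) (bd r) → _⊨A_ At (result At t) (hd r)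
  closed r r∈P R⊨bd with ⊨B-⋃-stage (Xs t) (mono t) (horn r r∈P) R⊨bd
  ... | n , Xₙ⊨bd = ⊨A-mono (hd r) (suc n ,_) (proj₂ (step t n) r r∈P Xₙ⊨bd)
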